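{- Let $Z \subseteq \overline{\mathbb{F}}$, let $x \in \mathbb{F}^*$ and $z \in Z$. Let $M_x = x\beta^{ -Q(x)}$, $M_z = z\beta^{ -Q(z)}$, $I = (\mathrm{fl}^{ -1}[Z] - z)\beta^{p-1-Q(z)}$ and $k = E(z/x) - (E(z) - E(x))$. If $|z/x| \le \max\mathbb{F}$, then (1) $x \otimes \mathrm{RD}(z/x) \in Z$ if and only if $-(M_z\beta^{p-1} \bmod M_x\beta^k) \in I$, and (2) $x \otimes \mathrm{RU}(z/x) \in Z$ if and only if $(-M_z\beta^{p-1} \bmod M_x\beta^k) \in I$.
   Context: Floating-point format: integers $\beta \ge 2$, $p \ge 1$, $e_{\min} \le e_{\max}$. $\mathbb{F}^* = \{M\beta^{e-p+1} : M,e \in \mathbb{Z},\ 0<|M|<\beta^p,\ e_{\min}\le e\le e_{\max}\}$, $\mathbb{F} = \mathbb{F}^*\cup\{0\}$, $\overline{\mathbb{F}} = \mathbb{F}\cup\{ -\infty,+\infty\}$. For real $x$: $E(x) = \lfloor \log_\beta |x|\rfloor$ if $|x| \ge \beta^{e_{\min}}$, else $E(x) = e_{\min}$; $Q(x) = E(x)-p+1$. $\mathrm{RD}(x) = \max\{y\in\overline{\mathbb{F}} : y \le x\}$, $\mathrm{RU}(x) = \min\{y \in \overline{\mathbb{F}} : y \ge x\}$. $\mathrm{fl}:\overline{\mathbb{R}}\to\overline{\mathbb{F}}$ is a fixed nondecreasing rounding function with $\mathrm{fl}(x)\in\{\mathrm{RD}(x),\mathrm{RU}(x)\}$ for all $x$;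 $x\otimes y = \mathrm{fl}(xy)$. $\mathrm{fl}^{ -1}[Z]$ is the preimage of $Z$. For real $a$ and nonzero real $b$, $(a \bmod b) = a - b\lfloor a/b\rfloor$.
   Formalization: The rounding function fl is defined on the extended rationals instead of $\overline{\mathbb{R}}$, so the preimage $\mathrm{fl}^{ -1}[Z]$ and the set I consist of rationals. -}

module Defs where

open import Data.Nat as ℕ using (ℕ; suc)
open import Data.Integer as ℤ using (ℤ; +_; -[1+_])
open import Data.Rational as ℚ using (ℚ; 0ℚ; 1ℚ; _+_; _*_; _-_; -_; ∣_∣; floor; _÷_; _≤ᵇ_)
open import Data.Rational.Properties using (_≟_)
open import Data.Rational.Base using (≢-nonZero)
open import Data.Product using (Σ; ∃; _×_)
open import Data.Sum using (_⊎_)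
open import Data.Unit using (⊤)
open import Data.Bool using (if_then_else_)
open import Relation.Binary.PropositionalEquality using (_≡_)
open import Relation.Nullary using (yes; no)

-- Total division on ℚ (value 0 when the divisor is 0; only ever used with nonzero divisors).
_÷T_ : ℚ → ℚ → ℚ
a ÷T b with b ≟ 0ℚ
... | yes _ = 0ℚ
... | no ne = _÷_ a b {{≢-nonZero ne}}

_modℚ_ : ℚ → ℚ → ℚ
a modℚ b = a - b * (floor (a ÷T b) ℚ./ 1)

nq : ℕ → ℚ
nq n = + n ℚ./ 1

zq : ℤ → ℚ
zq m = m ℚ./ 1

pow : ℕ → ℤ → ℚ
pow β (+ n)     = nq (β ℕ.^ n)
pow β -[1+ n ]  = 1ℚ ÷T nq (β ℕ.^ suc n)

-- extended rationals: stand-in for the extended reals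
data ℚ̄ : Set where
  -∞ +∞ : ℚ̄
  fin    : ℚ → ℚ̄

data _≤ᴱ_ : ℚ̄ → ℚ̄ → Set where
  -∞≤   : ∀ {a} → -∞ ≤ᴱ a
  ≤+∞   : ∀ {a} → a ≤ᴱ +∞
  fin≤  : ∀ {a b} → a ℚ.≤ b → fin a ≤ᴱ fin b

-- product of a nonzero rational x with an extended value
_⊙_ : ℚ → ℚ̄ → ℚ̄
x ⊙ fin r = fin (x * r)
x ⊙ +∞    = if 0ℚ ≤ᵇ x then +∞ else -∞
x ⊙ -∞    = if 0ℚ ≤ᵇ x then -∞ else +∞

record Format : Set where
  field
    β    : ℕ
    p    : ℕ
    emin : ℤ
    emax : ℤ

module _ (fmt : Format) where
  open Format fmt

  InFstar : ℚ → Set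
  InFstar q = Σ ℤ λ M → Σ ℤ λ e →
    (0 ℕ.< ℤ.∣ M ∣) × (ℤ.∣ M ∣ ℕ.< β ℕ.^ p) × (emin ℤ.≤ e) × (e ℤ.≤ emax)
    × (q ≡ zq M * pow β (e ℤ.- + p ℤ.+ + 1))

  InF : ℚ → Set
  InF q = (q ≡ 0ℚ) ⊎ InFstar q

  InFbar : ℚ̄ → Set
  InFbar -∞      = ⊤
  InFbar +∞      = ⊤
  InFbar (fin q) = InF q

  maxF : ℚ
  maxF = (nq (β ℕ.^ p) - 1ℚ) * pow β (emax ℤ.- + p ℤ.+ + 1)

  IsRD : ℚ̄ → ℚ̄ → Set
  IsRD r y = InFbar y × y ≤ᴱ r × (∀ y′ → InFbar y′ → y′ ≤ᴱ r → y′ ≤ᴱ y)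

  IsRU : ℚ̄ → ℚ̄ → Set
  IsRU r y = InFbar y × r ≤ᴱ y × (∀ y′ → InFbar y′ → r ≤ᴱ y′ → y ≤ᴱ y′)

  -- e = E(x): ⌊log_β |x|⌋ if |x| ≥ β^emin, and emin otherwise
  IsE : ℚ → ℤ → Set
  IsE x e = (pow β emin ℚ.≤ ∣ x ∣ × pow β e ℚ.≤ ∣ x ∣ × ∣ x ∣ ℚ.< pow β (e ℤ.+ + 1))
          ⊎ (∣ x ∣ ℚ.< pow β emin × e ≡ emin)

  QofE : ℤ → ℤ
  QofE e = e ℤ.- + p ℤ.+ + 1

  IsRoundingFn : (ℚ̄ → ℚ̄) → Set
  IsRoundingFn fl = (∀ a b → a ≤ᴱ b → fl a ≤ᴱ fl b)
                  × (∀ a → IsRD a (fl a) ⊎ IsRU a (fl a))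

  -- t ∈ I = (fl⁻¹[Z] - z) β^(p-1-Q(z))   (for real, here rational, t)
  InI : (fl : ℚ̄ → ℚ̄) (Z : ℚ̄ → Set) (z : ℚ) (Qz : ℤ) → ℚ → Set
  InI fl Z z Qz t = Σ ℚ λ w → Z (fl (fin w)) × (t ≡ (w - z) * pow β (+ p ℤ.- + 1 ℤ.- Qz))

-- Let c = z/x, E = E(c) and u = β^(E-p+1). Since |c| < β^(E+1) = βᵖ u and |c| ≤ max 𝔽,
-- RD(c) = ⌊c/u⌋ u: this multiple of u is a float (when ⌊c/u⌋ = -βᵖ it is -β^(E+1), whose exponent
-- E+1 still exists), and every float below c is either a multiple of u or smaller than β^E in
-- magnitude. Likewise RU(c) = -RD(-c). With S = β^(p-1-Q(z)) one has a = M_z β^(p-1) = c x S and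
-- b = M_x β^k = x u S, so a/b = c/u and the remainders are -(a mod b) = (x RD(c) - z) S and
-- (-a) mod b = (x RU(c) - z) S: exactly the points of I that correspond to x RD(c) and x RU(c).

module Submission where

open import Defs
open import Data.Nat as ℕ using (ℕ; suc; zero)
import Data.Nat.Properties as ℕP
import Data.Nat.Coprimality as Coprime
open import Data.Integer as ℤ using (ℤ; +_; -[1+_])
import Data.Integer.Properties as ℤP
import Data.Integer.DivMod as ℤD
import Data.Integer.Solver as ℤSolver
open import Data.Rational as ℚ using (ℚ; mkℚ; 0ℚ; 1ℚ; _+_; _*_; _-_; -_; ∣_∣; floor; _≤_; _<_)
import Data.Rational.Properties as QP
import Data.Rational.Solver as ℚSolver
open import Data.Product using (Σ; _,_; _×_)
open import Data.Sum using (inj₁; inj₂)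
open import Data.Empty using (⊥-elim)
open import Function using (_∘_)
open import Function.Bundles using (_⇔_; mk⇔)
open import Relation.Binary.PropositionalEquality
open import Relation.Nullary using (yes; no)

-- A module of its own: the ℤ and ℚ ring solvers export the same names.
module Exponents where
  open ℤSolver.+-*-Solver

  [E-P+1]+P≡E+1 : ∀ E P → (E ℤ.- P ℤ.+ + 1) ℤ.+ P ≡ E ℤ.+ + 1
  [E-P+1]+P≡E+1 = solve 2 (λ E P → (E :- P :+ con (+ 1)) :+ P := E :+ con (+ 1)) refl

  [E-P+1]+[P-1]≡E : ∀ E P → (E ℤ.- P ℤ.+ + 1) ℤ.+ (P ℤ.- + 1) ≡ E
  [E-P+1]+[P-1]≡E = solve 2 (λ E P → (E :- P :+ con (+ 1)) :+ (P :- con (+ 1)) := E) refl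

  suc[E-P+1]≡[E+1]-P+1 : ∀ E P → ℤ.suc (E ℤ.- P ℤ.+ + 1) ≡ (E ℤ.+ + 1) ℤ.- P ℤ.+ + 1
  suc[E-P+1]≡[E+1]-P+1 = solve 2 (λ E P → con (+ 1) :+ (E :- P :+ con (+ 1)) := (E :+ con (+ 1)) :- P :+ con (+ 1)) refl

  [E+m]-P+1≡[E-P+1]+m : ∀ E m P → (E ℤ.+ m) ℤ.- P ℤ.+ + 1 ≡ (E ℤ.- P ℤ.+ + 1) ℤ.+ m
  [E+m]-P+1≡[E-P+1]+m = solve 3 (λ E m P → (E :+ m) :- P :+ con (+ 1) := (E :- P :+ con (+ 1)) :+ m) refl

  -Qx+k≡Qzx+[p-1-Qz] : ∀ Ex Ez Ezx P →
    ℤ.- (Ex ℤ.- P ℤ.+ + 1) ℤ.+ (Ezx ℤ.- (Ez ℤ.- Ex)) ≡ (Ezx ℤ.- P ℤ.+ + 1) ℤ.+ (P ℤ.- + 1 ℤ.- (Ez ℤ.- P ℤ.+ + 1))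
  -Qx+k≡Qzx+[p-1-Qz] = solve 4 (λ Ex Ez Ezx P →
    :- (Ex :- P :+ con (+ 1)) :+ (Ezx :- (Ez :- Ex)) := (Ezx :- P :+ con (+ 1)) :+ (P :- con (+ 1) :- (Ez :- P :+ con (+ 1)))) refl

open Exponents
open ℚSolver.+-*-Solver

neg-involutive : ∀ q → - (- q) ≡ q
neg-involutive = solve 1 (λ q → :- (:- q) := q) refl

-- Integers inside ℚ

zq-def : ∀ m → zq m ≡ mkℚ m 0 (Coprime.sym (Coprime.1-coprimeTo _))
zq-def m = QP.↥p/↧p≡p (mkℚ m 0 (Coprime.sym (Coprime.1-coprimeTo _)))

zq-injective : ∀ {i j} → zq i ≡ zq j → i ≡ j
zq-injective {i} {j} e rewrite zq-def i | zq-def j = cong ℚ.numerator e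

zq-mono-≤ : ∀ {i j} → i ℤ.≤ j → zq i ≤ zq j
zq-mono-≤ {i} {j} h rewrite zq-def i | zq-def j =
  ℚ.*≤* (subst₂ ℤ._≤_ (sym (ℤP.*-identityʳ i)) (sym (ℤP.*-identityʳ j)) h)

zq-mono-< : ∀ {i j} → i ℤ.< j → zq i < zq j
zq-mono-< {i} {j} h rewrite zq-def i | zq-def j =
  ℚ.*<* (subst₂ ℤ._<_ (sym (ℤP.*-identityʳ i)) (sym (ℤP.*-identityʳ j)) h)

zq-cancel-< : ∀ {i j} → zq i < zq j → i ℤ.< j
zq-cancel-< {i} {j} h rewrite zq-def i | zq-def j with h
... | ℚ.*<* h′ = subst₂ ℤ._<_ (ℤP.*-identityʳ i) (ℤP.*-identityʳ j) h′

zq-+ : ∀ i j → zq (i ℤ.+ j) ≡ zq i + zq j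
zq-+ i j rewrite zq-def i | zq-def j =
  sym (cong₂ (λ a b → (a ℤ.+ b) ℚ./ 1) (ℤP.*-identityʳ i) (ℤP.*-identityʳ j))

zq-* : ∀ i j → zq (i ℤ.* j) ≡ zq i * zq j
zq-* i j rewrite zq-def i | zq-def j = refl

zq-neg : ∀ i → zq (ℤ.- i) ≡ - zq i
zq-neg (+ zero)   = refl
zq-neg (+ suc n)  = refl
zq-neg -[1+ n ]   = sym (neg-involutive (zq (+ suc n)))

∣zq∣ : ∀ i → ∣ zq i ∣ ≡ zq (+ ℤ.∣ i ∣)
∣zq∣ i rewrite zq-def i | zq-def (+ ℤ.∣ i ∣) = refl

nq-* : ∀ m n → nq (m ℕ.* n) ≡ nq m * nq n
nq-* m n = trans (cong zq (ℤP.pos-* m n)) (zq-* (+ m) (+ n))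

i≤j⇒j≡i+n : ∀ {i j} → i ℤ.≤ j → Σ ℕ λ n → j ≡ i ℤ.+ + n
i≤j⇒j≡i+n {i} {j} h = ℤ.∣ j ℤ.- i ∣ , (begin
    j                      ≡⟨ sym (ℤP.+-identityˡ j) ⟩
    ℤ.0ℤ ℤ.+ j             ≡⟨ cong (ℤ._+ j) (sym (ℤP.+-inverseʳ i)) ⟩
    i ℤ.- i ℤ.+ j          ≡⟨ ℤP.+-assoc i (ℤ.- i) j ⟩
    i ℤ.+ (ℤ.- i ℤ.+ j)    ≡⟨ cong (λ k → i ℤ.+ k) (ℤP.+-comm (ℤ.- i) j) ⟩
    i ℤ.+ (j ℤ.- i)        ≡⟨ cong (λ k → i ℤ.+ k) (sym (ℤP.0≤i⇒+∣i∣≡i (ℤP.i≤j⇒0≤j-i h))) ⟩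
    i ℤ.+ + ℤ.∣ j ℤ.- i ∣  ∎)
  where open ≡-Reasoning

i<suc[j]⇒i≤j : ∀ {i j} → i ℤ.< ℤ.suc j → i ℤ.≤ j
i<suc[j]⇒i≤j h = ℤP.≮⇒≥ (λ j<i → ℤP.<⇒≱ h (ℤP.i<j⇒suc[i]≤j j<i))

i+suc[j]≡suc[i+j] : ∀ i j → i ℤ.+ ℤ.suc j ≡ ℤ.suc (i ℤ.+ j)
i+suc[j]≡suc[i+j] i j = trans (sym (ℤP.+-assoc i ℤ.1ℤ j))
  (trans (cong (ℤ._+ j) (ℤP.+-comm i ℤ.1ℤ)) (ℤP.+-assoc ℤ.1ℤ i j))

-<i<⇒∣i∣< : ∀ {i m} → ℤ.- + m ℤ.< i → i ℤ.< + m → ℤ.∣ i ∣ ℕ.< m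
-<i<⇒∣i∣< {+ _} _ (ℤ.+<+ i<m) = i<m
-<i<⇒∣i∣< { -[1+ _ ]} {suc _} (ℤ.-<- i<m) _ = ℕ.s≤s i<m

floor-≤ : ∀ q → zq (floor q) ≤ q
floor-≤ q@(mkℚ num den _) rewrite zq-def (floor q) =
  ℚ.*≤* (subst₂ ℤ._≤_ refl (sym (ℤP.*-identityʳ num))
    (subst (f ℤ.* D ℤ.≤_) (sym (ℤD.a≡a%n+[a/n]*n num D)) (ℤP.i≤j+i (f ℤ.* D) (+ (num ℤD.% D)))))
  where D = + suc den
        f = num ℤ./ D

<-floor+1 : ∀ q → q < zq (ℤ.suc (floor q))
<-floor+1 q@(mkℚ num den _) rewrite zq-def (ℤ.suc (floor q)) =
  ℚ.*<* (subst₂ ℤ._<_ (sym (ℤP.*-identityʳ num)) refl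
    (subst (ℤ._< ℤ.suc f ℤ.* D) (sym (ℤD.a≡a%n+[a/n]*n num D))
      (subst (+ (num ℤD.% D) ℤ.+ f ℤ.* D ℤ.<_) (sym (ℤP.suc-* f D))
        (ℤP.+-monoˡ-< (f ℤ.* D) (ℤ.+<+ (ℤD.n%d<d num D))))))
  where D = + suc den
        f = num ℤ./ D

floor-greatest : ∀ q j → zq j ≤ q → j ℤ.≤ floor q
floor-greatest q j h = i<suc[j]⇒i≤j (zq-cancel-< (QP.≤-<-trans h (<-floor+1 q)))

÷T-*-cancel : ∀ a b → b ≢ 0ℚ → (a ÷T b) * b ≡ a
÷T-*-cancel a b b≢0 with b QP.≟ 0ℚ
... | yes b≡0 = ⊥-elim (b≢0 b≡0)
... | no b≢0′ = begin
    a * ℚ.1/ b * b    ≡⟨ QP.*-assoc a _ b ⟩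
    a * (ℚ.1/ b * b)  ≡⟨ cong (a *_) (QP.*-inverseˡ b) ⟩
    a * 1ℚ            ≡⟨ QP.*-identityʳ a ⟩
    a                 ∎
  where open ≡-Reasoning
        instance _ = ℚ.≢-nonZero b≢0′

*-cancelʳ-≡ : ∀ {x y} b → b ≢ 0ℚ → x * b ≡ y * b → x ≡ y
*-cancelʳ-≡ {x} {y} b b≢0 e = begin
    x                  ≡⟨ sym (QP.*-identityʳ x) ⟩
    x * 1ℚ             ≡⟨ cong (x *_) (sym (QP.*-inverseʳ b)) ⟩
    x * (b * ℚ.1/ b)   ≡⟨ sym (QP.*-assoc x b _) ⟩
    x * b * ℚ.1/ b     ≡⟨ cong (_* ℚ.1/ b) e ⟩
    y * b * ℚ.1/ b     ≡⟨ QP.*-assoc y b _ ⟩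
    y * (b * ℚ.1/ b)   ≡⟨ cong (y *_) (QP.*-inverseʳ b) ⟩
    y * 1ℚ             ≡⟨ QP.*-identityʳ y ⟩
    y                  ∎
  where open ≡-Reasoning
        instance _ = ℚ.≢-nonZero b≢0

÷T-unique : ∀ a b q → b ≢ 0ℚ → q * b ≡ a → a ÷T b ≡ q
÷T-unique a b q b≢0 e = *-cancelʳ-≡ b b≢0 (trans (÷T-*-cancel a b b≢0) (sym e))

*-≢0 : ∀ x y → x ≢ 0ℚ → y ≢ 0ℚ → x * y ≢ 0ℚ
*-≢0 x y x≢0 y≢0 e = x≢0 (*-cancelʳ-≡ y y≢0 (trans e (sym (QP.*-zeroˡ y))))

>⇒≢0 : ∀ {x} → 0ℚ < x → x ≢ 0ℚ
>⇒≢0 h e = QP.<-irrefl (sym e) h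

*-monoʳ-≤-0< : ∀ {p q} r → 0ℚ < r → p ≤ q → p * r ≤ q * r
*-monoʳ-≤-0< r 0<r = QP.*-monoʳ-≤-nonNeg r {{QP.pos⇒nonNeg r {{ℚ.positive 0<r}}}}

*-monoʳ-<-0< : ∀ {p q} r → 0ℚ < r → p < q → p * r < q * r
*-monoʳ-<-0< r 0<r = QP.*-monoˡ-<-pos r {{ℚ.positive 0<r}}

*-cancelʳ-≤-0< : ∀ {p q} r → 0ℚ < r → p * r ≤ q * r → p ≤ q
*-cancelʳ-≤-0< r 0<r = QP.*-cancelʳ-≤-pos r {{ℚ.positive 0<r}}

*-cancelʳ-<-0< : ∀ {p q} r → 0ℚ < r → p * r < q * r → p < q
*-cancelʳ-<-0< r 0<r = QP.*-cancelʳ-<-nonNeg r {{QP.pos⇒nonNeg r {{ℚ.positive 0<r}}}}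

p≤∣p∣ : ∀ p → p ≤ ∣ p ∣
p≤∣p∣ p with 0ℚ QP.≤? p
... | yes 0≤p = QP.≤-reflexive (sym (QP.0≤p⇒∣p∣≡p 0≤p))
... | no 0≰p = QP.<⇒≤ (QP.<-≤-trans (QP.≰⇒> 0≰p) (QP.0≤∣p∣ p))

-p≤∣p∣ : ∀ p → - p ≤ ∣ p ∣
-p≤∣p∣ p = subst (- p ≤_) (QP.∣-p∣≡∣p∣ p) (p≤∣p∣ (- p))

-∣p∣≤p : ∀ p → - ∣ p ∣ ≤ p
-∣p∣≤p p = subst (- ∣ p ∣ ≤_) (neg-involutive p) (QP.neg-antimono-≤ (-p≤∣p∣ p))

-- Rounding to a multiple

floorMultiple : ℚ → ℚ → ℚ
floorMultiple u c = zq (floor (c ÷T u)) * u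

module _ {u : ℚ} (0<u : 0ℚ < u) (c : ℚ) where

  ÷T-*-cancel-pos : (c ÷T u) * u ≡ c
  ÷T-*-cancel-pos = ÷T-*-cancel c u (>⇒≢0 0<u)

  floorMultiple-≤ : floorMultiple u c ≤ c
  floorMultiple-≤ = subst (floorMultiple u c ≤_) ÷T-*-cancel-pos (*-monoʳ-≤-0< u 0<u (floor-≤ (c ÷T u)))

  <-floorMultiple+u : c < zq (ℤ.suc (floor (c ÷T u))) * u
  <-floorMultiple+u = subst (_< zq (ℤ.suc (floor (c ÷T u))) * u) ÷T-*-cancel-pos (*-monoʳ-<-0< u 0<u (<-floor+1 (c ÷T u)))

  floorMultiple-greatest : ∀ j → zq j * u ≤ c → zq j * u ≤ floorMultiple u c
  floorMultiple-greatest j h = *-monoʳ-≤-0< u 0<u (zq-mono-≤ (floor-greatest (c ÷T u) j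
    (*-cancelʳ-≤-0< u 0<u (subst (zq j * u ≤_) (sym ÷T-*-cancel-pos) h))))

modℚ-multiple : ∀ c x u S → x ≢ 0ℚ → u ≢ 0ℚ → S ≢ 0ℚ →
                (c * x * S) modℚ (x * (u * S)) ≡ (c * x - x * floorMultiple u c) * S
modℚ-multiple c x u S x≢0 u≢0 S≢0 = begin
    c * x * S - x * (u * S) * zq (floor ((c * x * S) ÷T (x * (u * S))))  ≡⟨ cong (λ q → c * x * S - x * (u * S) * zq (floor q))
                                                                             (÷T-unique _ _ t (*-≢0 x _ x≢0 (*-≢0 u S u≢0 S≢0)) t*b≡a) ⟩
    c * x * S - x * (u * S) * zq (floor t)                              ≡⟨ solve 5 (λ c x u S n → c :* x :* S :- x :* (u :* S) :* n
                                                                                              := (c :* x :- x :* (n :* u)) :* S) refl c x u S _ ⟩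
    (c * x - x * floorMultiple u c) * S                                 ∎
  where
    open ≡-Reasoning
    t = c ÷T u
    t*b≡a : t * (x * (u * S)) ≡ c * x * S
    t*b≡a = begin
      t * (x * (u * S))  ≡⟨ solve 4 (λ t x u S → t :* (x :* (u :* S)) := t :* u :* x :* S) refl t x u S ⟩
      t * u * x * S      ≡⟨ cong (λ q → q * x * S) (÷T-*-cancel c u u≢0) ⟩
      c * x * S          ∎

-- Integer powers of the radix

module Powers (β : ℕ) (1<β : 1 ℕ.< β) where

  βⁿ>0 : ∀ n → 0 ℕ.< β ℕ.^ n
  βⁿ>0 n = ℕP.m^n>0 β n where instance _ = ℕ.>-nonZero (ℕP.<-trans (ℕ.s≤s ℕ.z≤n) 1<β)

  βⁿ≢0 : ∀ n → nq (β ℕ.^ n) ≢ 0ℚ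
  βⁿ≢0 n = >⇒≢0 (zq-mono-< (ℤ.+<+ (βⁿ>0 n)))

  nq-βⁿ⁺¹ : ∀ n → nq (β ℕ.^ suc n) ≡ nq β * nq (β ℕ.^ n)
  nq-βⁿ⁺¹ n = nq-* β (β ℕ.^ n)

  pow-suc : ∀ i → pow β (ℤ.suc i) ≡ pow β i * nq β
  pow-suc (+ n) = trans (nq-βⁿ⁺¹ n) (QP.*-comm (nq β) _)
  pow-suc -[1+ zero ] = sym (trans (cong (λ m → (1ℚ ÷T nq m) * nq β) (ℕP.*-identityʳ β))
                                   (÷T-*-cancel 1ℚ (nq β) (subst (λ m → nq m ≢ 0ℚ) (ℕP.*-identityʳ β) (βⁿ≢0 1))))
  pow-suc -[1+ suc n ] = ÷T-unique 1ℚ (nq (β ℕ.^ suc n)) _ (βⁿ≢0 (suc n)) (begin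
      (1ℚ ÷T βⁿ⁺²) * nq β * nq (β ℕ.^ suc n)    ≡⟨ QP.*-assoc (1ℚ ÷T βⁿ⁺²) (nq β) _ ⟩
      (1ℚ ÷T βⁿ⁺²) * (nq β * nq (β ℕ.^ suc n))  ≡⟨ cong ((1ℚ ÷T βⁿ⁺²) *_) (sym (nq-βⁿ⁺¹ (suc n))) ⟩
      (1ℚ ÷T βⁿ⁺²) * βⁿ⁺²                        ≡⟨ ÷T-*-cancel 1ℚ βⁿ⁺² (βⁿ≢0 (suc (suc n))) ⟩
      1ℚ                                        ∎)
    where open ≡-Reasoning
          βⁿ⁺² = nq (β ℕ.^ suc (suc n))

  pow-+ℕ : ∀ i n → pow β (i ℤ.+ + n) ≡ pow β i * nq (β ℕ.^ n)
  pow-+ℕ i zero = trans (cong (pow β) (ℤP.+-identityʳ i)) (sym (QP.*-identityʳ (pow β i)))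
  pow-+ℕ i (suc n) = begin
      pow β (i ℤ.+ + suc n)              ≡⟨ cong (pow β) (i+suc[j]≡suc[i+j] i (+ n)) ⟩
      pow β (ℤ.suc (i ℤ.+ + n))          ≡⟨ pow-suc (i ℤ.+ + n) ⟩
      pow β (i ℤ.+ + n) * nq β           ≡⟨ cong (_* nq β) (pow-+ℕ i n) ⟩
      pow β i * nq (β ℕ.^ n) * nq β      ≡⟨ solve 3 (λ a b c → a :* b :* c := a :* (c :* b)) refl (pow β i) _ (nq β) ⟩
      pow β i * (nq β * nq (β ℕ.^ n))    ≡⟨ cong (pow β i *_) (sym (nq-βⁿ⁺¹ n)) ⟩
      pow β i * nq (β ℕ.^ suc n)         ∎
    where open ≡-Reasoning

  pow-+ : ∀ i j → pow β (i ℤ.+ j) ≡ pow β i * pow β j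
  pow-+ i (+ n) = pow-+ℕ i n
  pow-+ i -[1+ n ] = *-cancelʳ-≡ βⁿ⁺¹ (βⁿ≢0 (suc n)) (begin
      pow β i′ * βⁿ⁺¹                         ≡⟨ sym (pow-+ℕ i′ (suc n)) ⟩
      pow β (i′ ℤ.+ + suc n)                  ≡⟨ cong (pow β) i′+n+1≡i ⟩
      pow β i                                 ≡⟨ sym (QP.*-identityʳ (pow β i)) ⟩
      pow β i * 1ℚ                            ≡⟨ cong (pow β i *_) (sym (÷T-*-cancel 1ℚ βⁿ⁺¹ (βⁿ≢0 (suc n)))) ⟩
      pow β i * (pow β -[1+ n ] * βⁿ⁺¹)       ≡⟨ sym (QP.*-assoc (pow β i) _ βⁿ⁺¹) ⟩
      pow β i * pow β -[1+ n ] * βⁿ⁺¹         ∎)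
    where open ≡-Reasoning
          i′ = i ℤ.+ -[1+ n ]
          βⁿ⁺¹ = nq (β ℕ.^ suc n)
          i′+n+1≡i : i′ ℤ.+ + suc n ≡ i
          i′+n+1≡i = trans (ℤP.+-assoc i -[1+ n ] (+ suc n))
                       (trans (cong (λ k → i ℤ.+ k) (ℤP.+-inverseˡ (+ suc n))) (ℤP.+-identityʳ i))

  pow-pos : ∀ i → 0ℚ < pow β i
  pow-pos (+ n) = zq-mono-< (ℤ.+<+ (βⁿ>0 n))
  pow-pos -[1+ n ] = *-cancelʳ-<-0< βⁿ⁺¹ (pow-pos (+ suc n)) (subst₂ _<_ (sym (QP.*-zeroˡ βⁿ⁺¹))
                       (sym (÷T-*-cancel 1ℚ βⁿ⁺¹ (βⁿ≢0 (suc n)))) (QP.positive⁻¹ 1ℚ))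
    where βⁿ⁺¹ = nq (β ℕ.^ suc n)

  pow-≢0 : ∀ i → pow β i ≢ 0ℚ
  pow-≢0 i = >⇒≢0 (pow-pos i)

  pow-mono-≤ : ∀ {i j} → i ℤ.≤ j → pow β i ≤ pow β j
  pow-mono-≤ {i} i≤j with i≤j⇒j≡i+n i≤j
  ... | n , refl = subst₂ _≤_ (QP.*-identityʳ (pow β i)) (sym (pow-+ℕ i n))
                     (QP.*-monoˡ-≤-nonNeg (pow β i) {{QP.pos⇒nonNeg (pow β i) {{ℚ.positive (pow-pos i)}}}}
                       (zq-mono-≤ (ℤ.+≤+ (βⁿ>0 n))))

  pow-<-pow-suc : ∀ i → pow β i < pow β (ℤ.suc i)
  pow-<-pow-suc i = subst₂ _<_ (QP.*-identityʳ (pow β i)) (sym (pow-suc i))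
                      (QP.*-monoʳ-<-pos (pow β i) {{ℚ.positive (pow-pos i)}} (zq-mono-< (ℤ.+<+ 1<β)))

  pow-cancel-< : ∀ {i j} → pow β i < pow β j → i ℤ.< j
  pow-cancel-< h = ℤP.≰⇒> (λ j≤i → QP.<-irrefl refl (QP.<-≤-trans h (pow-mono-≤ j≤i)))

  pow-+-+ : ∀ {i j k l} → i ℤ.+ j ≡ k ℤ.+ l → pow β i * pow β j ≡ pow β k * pow β l
  pow-+-+ {i} {j} {k} {l} e = trans (sym (pow-+ i j)) (trans (cong (pow β) e) (pow-+ k l))

-- Rounding down to a floating-point number

module Rounding (β p′ : ℕ) (emin emax : ℤ) (1<β : 1 ℕ.< β) (emin≤emax : emin ℤ.≤ emax) where
  open Powers β 1<β

  fmt : Format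
  fmt = record { β = β ; p = suc p′ ; emin = emin ; emax = emax }

  P : ℤ
  P = + suc p′

  βᵖ βᵖ⁻¹ : ℚ
  βᵖ = nq (β ℕ.^ suc p′)
  βᵖ⁻¹ = nq (β ℕ.^ p′)

  ulp : ℤ → ℚ
  ulp E = pow β (QofE fmt E)

  ulp-pos : ∀ E → 0ℚ < ulp E
  ulp-pos E = pow-pos (QofE fmt E)

  roundDown : ℚ → ℤ → ℚ
  roundDown c E = floorMultiple (ulp E) c

  pow[E+1]≡βᵖ*ulp : ∀ E → pow β (E ℤ.+ + 1) ≡ βᵖ * ulp E
  pow[E+1]≡βᵖ*ulp E = trans (cong (pow β) (sym ([E-P+1]+P≡E+1 E P))) (trans (pow-+ℕ (QofE fmt E) (suc p′)) (QP.*-comm (ulp E) βᵖ))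

  pow[E]≡βᵖ⁻¹*ulp : ∀ E → pow β E ≡ βᵖ⁻¹ * ulp E
  pow[E]≡βᵖ⁻¹*ulp E = trans (cong (pow β) (sym ([E-P+1]+[P-1]≡E E P))) (trans (pow-+ℕ (QofE fmt E) p′) (QP.*-comm (ulp E) βᵖ⁻¹))

  ulp-mono-≤ : ∀ {E E′} → E ℤ.≤ E′ → ulp E ≤ ulp E′
  ulp-mono-≤ E≤E′ = pow-mono-≤ (ℤP.+-monoˡ-≤ (+ 1) (ℤP.+-monoˡ-≤ (ℤ.- P) E≤E′))

  βᵖ⁻¹<βᵖ : β ℕ.^ p′ ℕ.< β ℕ.^ suc p′
  βᵖ⁻¹<βᵖ = ℕP.^-monoʳ-< β 1<β (ℕP.n<1+n p′)

  βᵖ⁻¹≤βᵖ-1 : βᵖ⁻¹ ≤ βᵖ - 1ℚ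
  βᵖ⁻¹≤βᵖ-1 = subst₂ _≤_ (solve 1 (λ a → (a :+ con 1ℚ) :- con 1ℚ := a) refl βᵖ⁻¹) refl
    (QP.+-monoˡ-≤ (- 1ℚ) (subst (_≤ βᵖ) (zq-+ (+ (β ℕ.^ p′)) (+ 1))
      (zq-mono-≤ (ℤ.+≤+ (subst (ℕ._≤ β ℕ.^ suc p′) (ℕP.+-comm 1 (β ℕ.^ p′)) βᵖ⁻¹<βᵖ)))))

  0≤βᵖ-1 : 0ℚ ≤ βᵖ - 1ℚ
  0≤βᵖ-1 = QP.≤-trans (QP.<⇒≤ (pow-pos (+ p′))) βᵖ⁻¹≤βᵖ-1

  maxF<pow[emax+1] : maxF fmt < pow β (emax ℤ.+ + 1)
  maxF<pow[emax+1] = subst (maxF fmt <_) (sym (pow[E+1]≡βᵖ*ulp emax))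
    (*-monoʳ-<-0< (ulp emax) (ulp-pos emax) (subst (βᵖ - 1ℚ <_) (QP.+-identityʳ βᵖ) (QP.+-monoʳ-< βᵖ (ℚ.*<* ℤ.-<+))))

  InF-neg : ∀ {y} → InF fmt y → InF fmt (- y)
  InF-neg (inj₁ refl) = inj₁ refl
  InF-neg (inj₂ (M , e , 0<∣M∣ , ∣M∣<βᵖ , emin≤e , e≤emax , refl)) =
    inj₂ (ℤ.- M , e , subst (0 ℕ.<_) (sym (ℤP.∣-i∣≡∣i∣ M)) 0<∣M∣ , subst (ℕ._< β ℕ.^ suc p′) (sym (ℤP.∣-i∣≡∣i∣ M)) ∣M∣<βᵖ ,
          emin≤e , e≤emax , trans (QP.neg-distribˡ-* (zq M) _) (cong (_* pow β (QofE fmt e)) (sym (zq-neg M))))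

  InFstar⇒≢0 : ∀ {x} → InFstar fmt x → x ≢ 0ℚ
  InFstar⇒≢0 (M , e , 0<∣M∣ , _ , _ , _ , refl) = *-≢0 (zq M) _ zq[M]≢0 (pow-≢0 (QofE fmt e))
    where zq[M]≢0 : zq M ≢ 0ℚ
          zq[M]≢0 e with zq-injective {M} {+ 0} e
          ... | refl = ℕP.<-irrefl refl 0<∣M∣

  IsE-neg : ∀ {c E} → IsE fmt c E → IsE fmt (- c) E
  IsE-neg {c} (inj₁ (a , b , d)) rewrite sym (QP.∣-p∣≡∣p∣ c) = inj₁ (a , b , d)
  IsE-neg {c} (inj₂ (a , b)) rewrite sym (QP.∣-p∣≡∣p∣ c) = inj₂ (a , b)

  IsE⇒∣∣<βᵖ*ulp : ∀ {c E} → IsE fmt c E → ∣ c ∣ < βᵖ * ulp E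
  IsE⇒∣∣<βᵖ*ulp {c} {E} (inj₁ (_ , _ , ∣c∣<βᴱ⁺¹)) = subst (∣ c ∣ <_) (pow[E+1]≡βᵖ*ulp E) ∣c∣<βᴱ⁺¹
  IsE⇒∣∣<βᵖ*ulp {c} {E} (inj₂ (∣c∣<βᵉᵐⁱⁿ , refl)) = subst (∣ c ∣ <_) (pow[E+1]≡βᵖ*ulp E)
    (QP.<-trans ∣c∣<βᵉᵐⁱⁿ (subst (λ k → pow β emin < pow β k) (ℤP.+-comm ℤ.1ℤ emin) (pow-<-pow-suc emin)))

  IsE⇒emin≤E : ∀ {c E} → IsE fmt c E → emin ℤ.≤ E
  IsE⇒emin≤E {E = E} (inj₁ (βᵉᵐⁱⁿ≤∣c∣ , _ , ∣c∣<βᴱ⁺¹)) =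
    i<suc[j]⇒i≤j (subst (emin ℤ.<_) (ℤP.+-comm E ℤ.1ℤ) (pow-cancel-< (QP.≤-<-trans βᵉᵐⁱⁿ≤∣c∣ ∣c∣<βᴱ⁺¹)))
  IsE⇒emin≤E (inj₂ (_ , refl)) = ℤP.≤-refl

  IsE⇒E≤emax : ∀ {c E} → IsE fmt c E → ∣ c ∣ ≤ maxF fmt → E ℤ.≤ emax
  IsE⇒E≤emax {E = E} (inj₁ (_ , βᴱ≤∣c∣ , _)) ∣c∣≤maxF =
    i<suc[j]⇒i≤j (subst (E ℤ.<_) (ℤP.+-comm emax ℤ.1ℤ)
      (pow-cancel-< (QP.≤-<-trans βᴱ≤∣c∣ (QP.≤-<-trans ∣c∣≤maxF maxF<pow[emax+1]))))
  IsE⇒E≤emax (inj₂ (_ , refl)) _ = emin≤emax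

  roundDownSignificand : ℚ → ℤ → ℤ
  roundDownSignificand c E = floor (c ÷T ulp E)

  module _ {c : ℚ} {E : ℤ} where
    private
      u = ulp E
      n = roundDownSignificand c E
      c/u*u≡c = ÷T-*-cancel-pos (ulp-pos E) c

    roundDownSignificand<βᵖ : IsE fmt c E → n ℤ.< + (β ℕ.^ suc p′)
    roundDownSignificand<βᵖ c-has-E = zq-cancel-< (QP.≤-<-trans (floor-≤ (c ÷T u))
      (*-cancelʳ-<-0< u (ulp-pos E) (subst (_< βᵖ * u) (sym c/u*u≡c) (QP.≤-<-trans (p≤∣p∣ c) (IsE⇒∣∣<βᵖ*ulp c-has-E)))))

    c<[1+n]*ulp : c < (1ℚ + zq n) * u
    c<[1+n]*ulp = subst (λ q → c < q * u) (zq-+ ℤ.1ℤ n) (<-floorMultiple+u (ulp-pos E) c)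

    -βᵖ≤roundDownSignificand : IsE fmt c E → ℤ.- + (β ℕ.^ suc p′) ℤ.≤ n
    -βᵖ≤roundDownSignificand c-has-E = i<suc[j]⇒i≤j (zq-cancel-< (subst (_< zq (ℤ.suc n)) (sym (zq-neg (+ (β ℕ.^ suc p′))))
      (*-cancelʳ-<-0< u (ulp-pos E) (QP.<-trans
        (subst (_< c) (QP.neg-distribˡ-* βᵖ u) (QP.<-≤-trans (QP.neg-antimono-< (IsE⇒∣∣<βᵖ*ulp c-has-E)) (-∣p∣≤p c)))
        (subst (λ q → c < q * u) (sym (zq-+ ℤ.1ℤ n)) c<[1+n]*ulp)))))

    [βᵖ-1]*ulp<∣c∣ : n ≡ ℤ.- + (β ℕ.^ suc p′) → (βᵖ - 1ℚ) * u < ∣ c ∣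
    [βᵖ-1]*ulp<∣c∣ n≡-βᵖ = QP.<-≤-trans (subst (_< - c) -[1-βᵖ]*u≡[βᵖ-1]*u (QP.neg-antimono-< c<[1-βᵖ]*u)) (-p≤∣p∣ c)
      where
        c<[1-βᵖ]*u : c < (1ℚ + - βᵖ) * u
        c<[1-βᵖ]*u = subst (λ k → c < (1ℚ + k) * u) (trans (cong zq n≡-βᵖ) (zq-neg (+ (β ℕ.^ suc p′)))) c<[1+n]*ulp
        -[1-βᵖ]*u≡[βᵖ-1]*u : - ((1ℚ + - βᵖ) * u) ≡ (βᵖ - 1ℚ) * u
        -[1-βᵖ]*u≡[βᵖ-1]*u = solve 2 (λ a b → :- ((con 1ℚ :+ (:- a)) :* b) := (a :- con 1ℚ) :* b) refl βᵖ u

    -- ⌊c/u⌋ = -βᵖ: the rounded value is -β^(E+1), representable because |c| ≤ max 𝔽 forces E < emax.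
    roundDown-carry-InF : IsE fmt c E → ∣ c ∣ ≤ maxF fmt → n ≡ ℤ.- + (β ℕ.^ suc p′) → InF fmt (roundDown c E)
    roundDown-carry-InF (inj₂ (∣c∣<βᵉᵐⁱⁿ , refl)) _ n≡-βᵖ = ⊥-elim (QP.<-irrefl refl (begin-strict
      ∣ c ∣              <⟨ ∣c∣<βᵉᵐⁱⁿ ⟩
      pow β emin         ≡⟨ pow[E]≡βᵖ⁻¹*ulp emin ⟩
      βᵖ⁻¹ * u           ≤⟨ *-monoʳ-≤-0< u (ulp-pos E) βᵖ⁻¹≤βᵖ-1 ⟩
      (βᵖ - 1ℚ) * u      <⟨ [βᵖ-1]*ulp<∣c∣ n≡-βᵖ ⟩
      ∣ c ∣              ∎))
      where open QP.≤-Reasoning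
    roundDown-carry-InF c-has-E@(inj₁ _) ∣c∣≤maxF n≡-βᵖ with E ℤ.<? emax
    ... | no E≮emax = ⊥-elim (QP.<-irrefl refl (begin-strict
      ∣ c ∣                    ≤⟨ ∣c∣≤maxF ⟩
      (βᵖ - 1ℚ) * ulp emax     ≤⟨ QP.*-monoˡ-≤-nonNeg (βᵖ - 1ℚ) {{ℚ.nonNegative 0≤βᵖ-1}} (ulp-mono-≤ (ℤP.≮⇒≥ E≮emax)) ⟩
      (βᵖ - 1ℚ) * u            <⟨ [βᵖ-1]*ulp<∣c∣ n≡-βᵖ ⟩
      ∣ c ∣                    ∎))
      where open QP.≤-Reasoning
    ... | yes E<emax = inj₂ (ℤ.- + (β ℕ.^ p′) , E ℤ.+ + 1 ,
            subst (0 ℕ.<_) (sym (ℤP.∣-i∣≡∣i∣ (+ (β ℕ.^ p′)))) (βⁿ>0 p′) ,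
            subst (ℕ._< β ℕ.^ suc p′) (sym (ℤP.∣-i∣≡∣i∣ (+ (β ℕ.^ p′)))) βᵖ⁻¹<βᵖ ,
            ℤP.≤-trans (IsE⇒emin≤E c-has-E) (ℤP.i≤i+j E (+ 1)) ,
            subst (ℤ._≤ emax) (ℤP.+-comm ℤ.1ℤ E) (ℤP.i<j⇒suc[i]≤j E<emax) ,
            roundDown≡-βᵖ⁻¹*ulp[E+1])
      where
        roundDown≡-βᵖ⁻¹*ulp[E+1] : roundDown c E ≡ zq (ℤ.- + (β ℕ.^ p′)) * ulp (E ℤ.+ + 1)
        roundDown≡-βᵖ⁻¹*ulp[E+1] = begin
          zq n * u                               ≡⟨ cong (λ k → zq k * u) n≡-βᵖ ⟩
          zq (ℤ.- + (β ℕ.^ suc p′)) * u          ≡⟨ cong (_* u) (zq-neg (+ (β ℕ.^ suc p′))) ⟩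
          - βᵖ * u                               ≡⟨ cong (λ k → - k * u) (nq-βⁿ⁺¹ p′) ⟩
          - (nq β * βᵖ⁻¹) * u                    ≡⟨ solve 3 (λ a b c → :- (a :* b) :* c := :- b :* (c :* a)) refl (nq β) βᵖ⁻¹ u ⟩
          - βᵖ⁻¹ * (u * nq β)                    ≡⟨ cong₂ _*_ (sym (zq-neg (+ (β ℕ.^ p′)))) (sym (pow-suc (QofE fmt E))) ⟩
          zq (ℤ.- + (β ℕ.^ p′)) * pow β (ℤ.suc (QofE fmt E))   ≡⟨ cong (λ k → zq (ℤ.- + (β ℕ.^ p′)) * pow β k) (suc[E-P+1]≡[E+1]-P+1 E P) ⟩
          zq (ℤ.- + (β ℕ.^ p′)) * ulp (E ℤ.+ + 1) ∎
          where open ≡-Reasoning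

    roundDown-InF : IsE fmt c E → ∣ c ∣ ≤ maxF fmt → InF fmt (roundDown c E)
    roundDown-InF c-has-E ∣c∣≤maxF with n ℤ.≟ + 0 | n ℤ.≟ ℤ.- + (β ℕ.^ suc p′)
    ... | yes n≡0 | _ = inj₁ (trans (cong (λ k → zq k * u) n≡0) (QP.*-zeroˡ u))
    ... | no _ | yes n≡-βᵖ = roundDown-carry-InF c-has-E ∣c∣≤maxF n≡-βᵖ
    ... | no n≢0 | no n≢-βᵖ = inj₂ (n , E , ℕP.n≢0⇒n>0 (n≢0 ∘ ℤP.∣i∣≡0⇒i≡0) ,
            -<i<⇒∣i∣< (ℤP.≤∧≢⇒< (-βᵖ≤roundDownSignificand c-has-E) (n≢-βᵖ ∘ sym)) (roundDownSignificand<βᵖ c-has-E) ,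
            IsE⇒emin≤E c-has-E , IsE⇒E≤emax c-has-E ∣c∣≤maxF , refl)

    ∣M*ulp[e]∣<pow[E] : ∀ M e → ℤ.∣ M ∣ ℕ.< β ℕ.^ suc p′ → e ℤ.< E → ∣ zq M * ulp e ∣ < pow β E
    ∣M*ulp[e]∣<pow[E] M e ∣M∣<βᵖ e<E = begin-strict
      ∣ zq M * ulp e ∣              ≡⟨ QP.∣p*q∣≡∣p∣*∣q∣ (zq M) (ulp e) ⟩
      ∣ zq M ∣ * ∣ ulp e ∣          ≡⟨ cong₂ _*_ (∣zq∣ M) (QP.0≤p⇒∣p∣≡p (QP.<⇒≤ (ulp-pos e))) ⟩
      zq (+ ℤ.∣ M ∣) * ulp e        <⟨ *-monoʳ-<-0< (ulp e) (ulp-pos e) (zq-mono-< (ℤ.+<+ ∣M∣<βᵖ)) ⟩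
      βᵖ * ulp e                    ≡⟨ pow[E+1]≡βᵖ*ulp e ⟨
      pow β (e ℤ.+ + 1)             ≤⟨ pow-mono-≤ (subst (ℤ._≤ E) (ℤP.+-comm ℤ.1ℤ e) (ℤP.i<j⇒suc[i]≤j e<E)) ⟩
      pow β E                       ∎
      where open QP.≤-Reasoning

    -- A float of exponent e < E lies strictly between -β^E and β^E; for c ≥ 0 the multiple β^E of u
    -- is still below c, and for c < 0 such a float cannot be below c.
    roundDown-greatest-below-binade : IsE fmt c E → ∀ M e → ℤ.∣ M ∣ ℕ.< β ℕ.^ suc p′ → emin ℤ.≤ e → e ℤ.< E →
                                      zq M * ulp e ≤ c → zq M * ulp e ≤ roundDown c E
    roundDown-greatest-below-binade (inj₂ (_ , refl)) M e _ emin≤e e<E _ = ⊥-elim (ℤP.<⇒≱ e<E emin≤e)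
    roundDown-greatest-below-binade (inj₁ (_ , βᴱ≤∣c∣ , _)) M e ∣M∣<βᵖ _ e<E y≤c with 0ℚ QP.≤? c
    ... | yes 0≤c = QP.<⇒≤ (begin-strict
      y                  ≤⟨ p≤∣p∣ y ⟩
      ∣ y ∣              <⟨ ∣M*ulp[e]∣<pow[E] M e ∣M∣<βᵖ e<E ⟩
      pow β E            ≡⟨ pow[E]≡βᵖ⁻¹*ulp E ⟩
      βᵖ⁻¹ * u           ≤⟨ floorMultiple-greatest (ulp-pos E) c (+ (β ℕ.^ p′))
                             (subst₂ _≤_ (pow[E]≡βᵖ⁻¹*ulp E) (QP.0≤p⇒∣p∣≡p 0≤c) βᴱ≤∣c∣) ⟩
      roundDown c E      ∎)
      where open QP.≤-Reasoning
            y = zq M * ulp e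
    ... | no 0≰c = ⊥-elim (QP.<-irrefl refl (begin-strict
      ∣ c ∣              ≡⟨ ∣c∣≡-c ⟩
      - c                ≤⟨ QP.neg-antimono-≤ y≤c ⟩
      - y                ≤⟨ -p≤∣p∣ y ⟩
      ∣ y ∣              <⟨ ∣M*ulp[e]∣<pow[E] M e ∣M∣<βᵖ e<E ⟩
      pow β E            ≤⟨ βᴱ≤∣c∣ ⟩
      ∣ c ∣              ∎))
      where open QP.≤-Reasoning
            y = zq M * ulp e
            ∣c∣≡-c : ∣ c ∣ ≡ - c
            ∣c∣≡-c with QP.∣p∣≡p∨∣p∣≡-p c
            ... | inj₁ ∣c∣≡c = ⊥-elim (0≰c (QP.∣p∣≡p⇒0≤p ∣c∣≡c))
            ... | inj₂ ∣c∣≡-c = ∣c∣≡-c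

    roundDown-greatest : IsE fmt c E → ∀ {y} → InF fmt y → y ≤ c → y ≤ roundDown c E
    roundDown-greatest _ (inj₁ refl) 0≤c =
      subst (_≤ roundDown c E) (QP.*-zeroˡ u) (floorMultiple-greatest (ulp-pos E) c (+ 0) (subst (_≤ c) (sym (QP.*-zeroˡ u)) 0≤c))
    roundDown-greatest c-has-E (inj₂ (M , e , _ , ∣M∣<βᵖ , emin≤e , _ , refl)) y≤c with E ℤ.≤? e
    ... | no E≰e = roundDown-greatest-below-binade c-has-E M e ∣M∣<βᵖ emin≤e (ℤP.≰⇒> E≰e) y≤c
    ... | yes E≤e with i≤j⇒j≡i+n E≤e
    ...   | m , refl = subst (_≤ roundDown c E) (sym y≡M*βᵐ*u)
                         (floorMultiple-greatest (ulp-pos E) c (M ℤ.* + (β ℕ.^ m)) (subst (_≤ c) y≡M*βᵐ*u y≤c))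
      where
        y≡M*βᵐ*u : zq M * ulp (E ℤ.+ + m) ≡ zq (M ℤ.* + (β ℕ.^ m)) * u
        y≡M*βᵐ*u = begin
          zq M * ulp (E ℤ.+ + m)                  ≡⟨ cong (λ k → zq M * pow β k) ([E+m]-P+1≡[E-P+1]+m E (+ m) P) ⟩
          zq M * pow β (QofE fmt E ℤ.+ + m)        ≡⟨ cong (zq M *_) (pow-+ℕ (QofE fmt E) m) ⟩
          zq M * (u * nq (β ℕ.^ m))               ≡⟨ solve 3 (λ a b c → a :* (b :* c) := a :* c :* b) refl (zq M) u (nq (β ℕ.^ m)) ⟩
          zq M * nq (β ℕ.^ m) * u                 ≡⟨ cong (_* u) (zq-* M (+ (β ℕ.^ m))) ⟨
          zq (M ℤ.* + (β ℕ.^ m)) * u              ∎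
          where open ≡-Reasoning

  IsRD⇒≡roundDown : ∀ {c E} → IsE fmt c E → ∣ c ∣ ≤ maxF fmt → ∀ d → IsRD fmt (fin c) d → d ≡ fin (roundDown c E)
  IsRD⇒≡roundDown {c} {E} c-has-E ∣c∣≤maxF d (_ , _ , greatest)
    with greatest (fin (roundDown c E)) (roundDown-InF c-has-E ∣c∣≤maxF) (fin≤ (floorMultiple-≤ (ulp-pos E) c))
  IsRD⇒≡roundDown c-has-E _ (fin d) (d∈F , fin≤ d≤c , _) | fin≤ rd≤d =
    cong fin (QP.≤-antisym (roundDown-greatest c-has-E d∈F d≤c) rd≤d)

  IsRU⇒≡-roundDown-neg : ∀ {c E} → IsE fmt c E → ∣ c ∣ ≤ maxF fmt → ∀ d → IsRU fmt (fin c) d → d ≡ fin (- roundDown (- c) E)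
  IsRU⇒≡-roundDown-neg {c} {E} c-has-E ∣c∣≤maxF d (_ , _ , least)
    with least (fin (- roundDown (- c) E)) (InF-neg (roundDown-InF -c-has-E ∣-c∣≤maxF))
               (fin≤ (subst (_≤ - roundDown (- c) E) (neg-involutive c) (QP.neg-antimono-≤ (floorMultiple-≤ (ulp-pos E) (- c)))))
    where -c-has-E = IsE-neg c-has-E
          ∣-c∣≤maxF = subst (_≤ maxF fmt) (sym (QP.∣-p∣≡∣p∣ c)) ∣c∣≤maxF
  IsRU⇒≡-roundDown-neg {c} {E} c-has-E _ (fin d) (d∈F , fin≤ c≤d , _) | fin≤ d≤ru =
    cong fin (QP.≤-antisym d≤ru (subst (- roundDown (- c) E ≤_) (neg-involutive d)
      (QP.neg-antimono-≤ (roundDown-greatest (IsE-neg c-has-E) (InF-neg d∈F) (QP.neg-antimono-≤ c≤d)))))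

  fl⁻¹⇔InI : ∀ (fl : ℚ̄ → ℚ̄) Z z Qz w → Z (fl (fin w)) ⇔ InI fmt fl Z z Qz ((w - z) * pow β (P ℤ.- + 1 ℤ.- Qz))
  fl⁻¹⇔InI fl Z z Qz w = mk⇔ (λ w∈fl⁻¹Z → w , w∈fl⁻¹Z , refl)
    (λ { (w′ , w′∈fl⁻¹Z , e) → subst (λ v → Z (fl (fin v))) (w′≡w w′ (sym e)) w′∈fl⁻¹Z })
    where
      w′≡w : ∀ w′ → (w′ - z) * pow β (P ℤ.- + 1 ℤ.- Qz) ≡ (w - z) * pow β (P ℤ.- + 1 ℤ.- Qz) → w′ ≡ w
      w′≡w w′ e = begin
        w′               ≡⟨ solve 2 (λ w z → w := (w :- z) :+ z) refl w′ z ⟩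
        (w′ - z) + z     ≡⟨ cong (_+ z) (*-cancelʳ-≡ {w′ - z} {w - z} _ (pow-≢0 (P ℤ.- + 1 ℤ.- Qz)) e) ⟩
        (w - z) + z      ≡⟨ solve 2 (λ w z → (w :- z) :+ z := w) refl w z ⟩
        w                ∎
        where open ≡-Reasoning

  Mz·βᵖ⁻¹ : ℚ → ℤ → ℚ
  Mz·βᵖ⁻¹ z Ez = z * pow β (ℤ.- QofE fmt Ez) * pow β (P ℤ.- + 1)

  Mx·βᵏ : ℚ → ℤ → ℤ → ℤ → ℚ
  Mx·βᵏ x Ex Ez Ezx = x * pow β (ℤ.- QofE fmt Ex) * pow β (Ezx ℤ.- (Ez ℤ.- Ex))

  module _ {x : ℚ} (x≢0 : x ≢ 0ℚ) (z : ℚ) (Ex Ez Ezx : ℤ) where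
    private
      c = z ÷T x
      S = pow β (P ℤ.- + 1 ℤ.- QofE fmt Ez)
      c*x≡z = ÷T-*-cancel z x x≢0

      a≡c*x*S : Mz·βᵖ⁻¹ z Ez ≡ c * x * S
      a≡c*x*S = begin
        z * pow β (ℤ.- QofE fmt Ez) * pow β (P ℤ.- + 1)   ≡⟨ QP.*-assoc z _ _ ⟩
        z * (pow β (ℤ.- QofE fmt Ez) * pow β (P ℤ.- + 1)) ≡⟨ cong (z *_) (trans (sym (pow-+ (ℤ.- QofE fmt Ez) (P ℤ.- + 1)))
                                                              (cong (pow β) (ℤP.+-comm (ℤ.- QofE fmt Ez) (P ℤ.- + 1)))) ⟩
        z * S                                             ≡⟨ cong (_* S) c*x≡z ⟨
        c * x * S                                         ∎
        where open ≡-Reasoning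

      b≡x*[ulp*S] : Mx·βᵏ x Ex Ez Ezx ≡ x * (ulp Ezx * S)
      b≡x*[ulp*S] = trans (QP.*-assoc x _ _) (cong (x *_)
        (pow-+-+ {ℤ.- QofE fmt Ex} {Ezx ℤ.- (Ez ℤ.- Ex)} {QofE fmt Ezx} {P ℤ.- + 1 ℤ.- QofE fmt Ez} (-Qx+k≡Qzx+[p-1-Qz] Ex Ez Ezx P)))

      remainder : ∀ c′ → (c′ * x * S) modℚ Mx·βᵏ x Ex Ez Ezx ≡ (c′ * x - x * roundDown c′ Ezx) * S
      remainder c′ = trans (cong ((c′ * x * S) modℚ_) b≡x*[ulp*S])
        (modℚ-multiple c′ x (ulp Ezx) S x≢0 (pow-≢0 (QofE fmt Ezx)) (pow-≢0 (P ℤ.- + 1 ℤ.- QofE fmt Ez)))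

    -[a-mod-b]≡[x*roundDown-z]*S : - (Mz·βᵖ⁻¹ z Ez modℚ Mx·βᵏ x Ex Ez Ezx) ≡ (x * roundDown c Ezx - z) * S
    -[a-mod-b]≡[x*roundDown-z]*S = begin
      - (Mz·βᵖ⁻¹ z Ez modℚ Mx·βᵏ x Ex Ez Ezx)     ≡⟨ cong (λ a → - (a modℚ Mx·βᵏ x Ex Ez Ezx)) a≡c*x*S ⟩
      - ((c * x * S) modℚ Mx·βᵏ x Ex Ez Ezx)      ≡⟨ cong -_ (remainder c) ⟩
      - ((c * x - x * roundDown c Ezx) * S)       ≡⟨ solve 4 (λ cx x r S → :- ((cx :- x :* r) :* S) := (x :* r :- cx) :* S) refl (c * x) x _ S ⟩
      (x * roundDown c Ezx - c * x) * S           ≡⟨ cong (λ z′ → (x * roundDown c Ezx - z′) * S) c*x≡z ⟩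
      (x * roundDown c Ezx - z) * S               ∎
      where open ≡-Reasoning

    [-a]-mod-b≡[x*-roundDown-neg-z]*S : (- Mz·βᵖ⁻¹ z Ez) modℚ Mx·βᵏ x Ex Ez Ezx ≡ (x * - roundDown (- c) Ezx - z) * S
    [-a]-mod-b≡[x*-roundDown-neg-z]*S = begin
      (- Mz·βᵖ⁻¹ z Ez) modℚ Mx·βᵏ x Ex Ez Ezx      ≡⟨ cong (_modℚ Mx·βᵏ x Ex Ez Ezx) (trans (cong -_ a≡c*x*S)
                                                       (solve 3 (λ c x S → :- (c :* x :* S) := :- c :* x :* S) refl c x S)) ⟩
      ((- c) * x * S) modℚ Mx·βᵏ x Ex Ez Ezx       ≡⟨ remainder (- c) ⟩
      ((- c) * x - x * roundDown (- c) Ezx) * S    ≡⟨ solve 4 (λ c x r S → (:- c :* x :- x :* r) :* S := (x :* (:- r) :- c :* x) :* S) refl c x _ S ⟩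
      (x * - roundDown (- c) Ezx - c * x) * S      ≡⟨ cong (λ z′ → (x * - roundDown (- c) Ezx - z′) * S) c*x≡z ⟩
      (x * - roundDown (- c) Ezx - z) * S          ∎
      where open ≡-Reasoning

mainTheorem16 : (fmt : Format) →
    let open Format fmt in
    2 ℕ.≤ β → 1 ℕ.≤ p → emin ℤ.≤ emax →
    (fl : ℚ̄ → ℚ̄) → IsRoundingFn fmt fl →
    (Z : ℚ̄ → Set) → (∀ y → Z y → InFbar fmt y) →
    (x z : ℚ) → InFstar fmt x → Z (fin z) →
    (Ex Ez Ezx : ℤ) → IsE fmt x Ex → IsE fmt z Ez → IsE fmt (z ÷T x) Ezx →
    let Qx = QofE fmt Ex
        Qz = QofE fmt Ez
        Mx = x * pow β (ℤ.- Qx)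
        Mz = z * pow β (ℤ.- Qz)
        k = Ezx ℤ.- (Ez ℤ.- Ex)
        a = Mz * pow β (+ p ℤ.- + 1)
        b = Mx * pow β k
    in
    ∣ z ÷T x ∣ ℚ.≤ maxF fmt →
    ((d : ℚ̄) → IsRD fmt (fin (z ÷T x)) d →
        (Z (fl (x ⊙ d)) ⇔ InI fmt fl Z z Qz (- (a modℚ b))))
    ×
    ((u : ℚ̄) → IsRU fmt (fin (z ÷T x)) u →
        (Z (fl (x ⊙ u)) ⇔ InI fmt fl Z z Qz ((- a) modℚ b)))
mainTheorem16 record { p = zero } _ ()
mainTheorem16 record { β = β ; p = suc p′ ; emin = emin ; emax = emax }
              1<β _ emin≤emax fl _ Z _ x z x∈F* _ Ex Ez Ezx _ _ c-has-E ∣c∣≤maxF =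
    (λ d d-is-RD → point-of-I (IsRD⇒≡roundDown c-has-E ∣c∣≤maxF d d-is-RD) (-[a-mod-b]≡[x*roundDown-z]*S x≢0 z Ex Ez Ezx))
  , (λ d d-is-RU → point-of-I (IsRU⇒≡-roundDown-neg c-has-E ∣c∣≤maxF d d-is-RU) ([-a]-mod-b≡[x*-roundDown-neg-z]*S x≢0 z Ex Ez Ezx))
  where
    open Rounding β p′ emin emax 1<β emin≤emax
    x≢0 = InFstar⇒≢0 x∈F*
    Qz = QofE fmt Ez

    point-of-I : ∀ {d v t} → d ≡ fin v → t ≡ (x * v - z) * pow β (P ℤ.- + 1 ℤ.- Qz) → Z (fl (x ⊙ d)) ⇔ InI fmt fl Z z Qz t
    point-of-I {v = v} refl refl = fl⁻¹⇔InI fl Z z Qz (x * v)
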